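{- Let $\mathcal{B}$ be a $\oplus$-BADC of size $n$. There is a constant $C$ (independent of $\mathcal{B}$) such that for every configuration $x$ that is not a fixed point and every configuration $y$ that is not unreachable, $y$ can be reached from $x$ by at most $Cn^2$ asynchronous updates. Moreover this quadratic bound is tight: there exist a constant $c>0$ and $\oplus$-BADCs of arbitrarily large size $n$ with such a pair $x,y$ for which every sequence of asynchronous updates from $x$ to $y$ has length at least $cn^2$.
   Context: A $\oplus$-Boolean automata double-cycle ($\oplus$-BADC) of size $(n_1,n_2)$, $n_1,n_2\ge1$, has two directed cycles $\mathcal{C}_1=(i^1_1,\dots,i^1_{n_1})$ and $\mathcal{C}_2=(i^2_1,\dots,i^2_{n_2})$ whose automata are all distinct except the central automaton $o=i^1_1=i^2_1$; its size is $n=n_1+n_2-1$. Local functions: $f_{i^k_j}(x)=\sigma_{k,j}(x_{i^k_{j-1}})$ for $j\ge2$, and $f_o(x)=\sigma_1(x_{i^1_{n_1}})\oplus\sigma_2(x_{i^2_{n_2}})$ (with $i^k_{n_k}=o$ if $n_k=1$), each $\sigma$ identity or negation. The asynchronous update of automaton $i$ replaces $x_i$ by $f_i(x)$, leaving other coordinates unchanged. $y$ is reachable from $x$ if obtained by a finite sequence of such updates. A fixed point satisfies $f_i(x)=x_i$ for all $i$. $y$ is unreachable if no configuration $z\neq y$ is mapped to $y$ by a single asynchronous update. -}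

module Defs where

open import Data.Bool using (Bool; true; false; if_then_else_; _xor_)
open import Data.Nat using (ℕ; zero; suc; _+_; _*_; _≤_; _<_; _≡ᵇ_)
open import Data.Fin using (Fin; zero; suc; fromℕ; inject₁)
import Data.Fin as F
open import Data.List using (List; []; _∷_; length)
open import Data.Product using (Σ; _×_; _,_; ∃; ∃-syntax)
open import Relation.Binary.PropositionalEquality using (_≡_)
open import Relation.Nullary using (¬_)

-- Automata: the central automaton o, the automata i¹₂ … i¹_{n₁} of cycle 1
-- (indexed by Fin a: index j stands for i¹_{j+2}) and the automata
-- i²₂ … i²_{n₂} of cycle 2 (indexed by Fin b).
data Node (a b : ℕ) : Set where
  center : Node a b
  left   : Fin a → Node a b
  right  : Fin b → Node a b

-- Each sign σ is encoded by a Bool: false = identity, true = negation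
-- (σ(v) = s xor v).
record BADC : Set where
  field
    a b  : ℕ                 -- n₁ = suc a, n₂ = suc b
    sig1 : Fin a → Bool      -- σ_{1,j+2}
    sig2 : Fin b → Bool      -- σ_{2,j+2}
    tau1 : Bool              -- σ₁ (on the arc i¹_{n₁} → o)
    tau2 : Bool              -- σ₂ (on the arc i²_{n₂} → o)

open BADC public

-- size n = n₁ + n₂ - 1
size : BADC → ℕ
size B = a B + b B + 1

Automaton : BADC → Set
Automaton B = Node (a B) (b B)

Config : BADC → Set
Config B = Automaton B → Bool

_≈_ : ∀ {B} → Config B → Config B → Set
x ≈ y = ∀ i → x i ≡ y i

predL : ∀ {a b} → Fin a → Node a b
predL zero    = center
predL (suc j) = left (inject₁ j)

predR : ∀ {a b} → Fin b → Node a b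
predR zero    = center
predR (suc j) = right (inject₁ j)

last1 : ∀ {a b} → Node a b
last1 {zero}  = center
last1 {suc a} = left (fromℕ a)

last2 : ∀ {a b} → Node a b
last2 {b = zero}  = center
last2 {b = suc b} = right (fromℕ b)

f : (B : BADC) → Automaton B → Config B → Bool
f B center    x = (tau1 B xor x last1) xor (tau2 B xor x last2)
f B (left j)  x = sig1 B j xor x (predL j)
f B (right j) x = sig2 B j xor x (predR j)

sameNode : ∀ {a b} → Node a b → Node a b → Bool
sameNode center    center    = true
sameNode (left i)  (left j)  = (F.toℕ i ≡ᵇ F.toℕ j)
sameNode (right i) (right j) = (F.toℕ i ≡ᵇ F.toℕ j)
sameNode _         _         = false

update : (B : BADC) → Automaton B → Config B → Config B
update B i x j = if sameNode i j then f B i x else x j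

run : (B : BADC) → List (Automaton B) → Config B → Config B
run B []       x = x
run B (i ∷ is) x = run B is (update B i x)

FixedPoint : (B : BADC) → Config B → Set
FixedPoint B x = ∀ i → f B i x ≡ x i

Unreachable : (B : BADC) → Config B → Set
Unreachable B y = ∀ (z : Config B) (i : Automaton B) → _≈_ {B} (update B i z) y → _≈_ {B} z y

ReachableWithin : (B : BADC) → ℕ → Config B → Config B → Set
ReachableWithin B m x y = Σ (List (Automaton B)) λ ws → (length ws ≤ m) × (_≈_ {B} (run B ws x) y)

module Submission where

-- Call an automaton unstable when its update would change its state. An
-- update of an unstable automaton makes it stable and toggles the
-- instability of its successor(s) (both cycles for the central automaton),
-- so instabilities behave like tokens travelling along the two cycles and
-- cancelling in pairs.
--
-- Upper bound: on token states any state with a token reaches any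
-- non-blocked state in 7n² updates. All tokens are first gathered into a
-- single token on the central automaton (gather, O(n) updates, using the
-- parity of the number of tokens); the target is then written bit by bit
-- (Writer, O(n²)) or carved out of full chains (TwoChains, OneChain).
-- Lower bound: the sum of the token positions on cycle 1 grows by at most
-- one per update, and on a single long cycle it must grow from 0 to n²/4.

open import Defs
open import Data.Bool using (Bool; true; false; not; _xor_; _∧_; _∨_; if_then_else_; T)
open import Data.Bool.Properties
  using (_≟_; ¬-not; not-involutive; xor-comm; xor-assoc; xor-identityʳ; xor-same; xor-inverseˡ;
         xor-annihilates-not; ∧-zeroʳ; ∧-identityʳ; xor-∧-commutativeRing)
open import Data.Empty using (⊥; ⊥-elim)
open import Data.Fin using (Fin; zero; suc; toℕ; fromℕ)
open import Data.Fin.Induction using (<-weakInduction)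
open import Data.Fin.Properties using (toℕ-injective; toℕ-inject₁; toℕ-fromℕ)
open import Data.List using (List; []; _∷_; _++_; length; map; [_])
open import Data.List.Properties using (length-map; length-++)
open import Data.Maybe using (just; nothing)
open import Data.Nat using (ℕ; zero; suc; _+_; _*_; _≤_; _<_; z≤n; s≤s; _≡ᵇ_)
open import Data.Nat.Properties
  using (≤-refl; ≤-trans; ≤-reflexive; n≤1+n; m≤m+n; m≤n+m; m≤m*n; ≡ᵇ⇒≡; +-comm; +-suc; +-identityʳ;
         +-mono-≤; +-monoʳ-≤; *-mono-≤; *-monoʳ-≤; module ≤-Reasoning)
import Data.Nat.Tactic.RingSolver as ℕ
open import Data.Product using (Σ; _×_; _,_)
open import Data.Vec using (Vec; []; _∷_; replicate; lookup; tabulate)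
open import Data.Vec.Properties using (lookup-replicate; lookup∘tabulate; tabulate∘lookup; tabulate-cong)
open import Function using (_∘_)
open import Level using (0ℓ)
open import Relation.Binary.PropositionalEquality
  using (_≡_; _≢_; refl; sym; trans; cong; cong₂; subst; module ≡-Reasoning)
open import Relation.Nullary using (¬_; yes; no)
open import Tactic.RingSolver using (solve-∀)
open import Tactic.RingSolver.Core.AlmostCommutativeRing using (AlmostCommutativeRing; fromCommutativeRing)

-- Rearrangements of xor/∧ expressions are normalised in the commutative
-- ring (Bool, xor, ∧).
BoolRing : AlmostCommutativeRing 0ℓ 0ℓ
BoolRing = fromCommutativeRing xor-∧-commutativeRing λ { false → just refl ; true → nothing }

xor-cancelʳ : ∀ x y → (x xor y) xor y ≡ x
xor-cancelʳ false false = refl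
xor-cancelʳ false true  = refl
xor-cancelʳ true  false = refl
xor-cancelʳ true  true  = refl

xor-cancelˡ : ∀ x y → x xor (x xor y) ≡ y
xor-cancelˡ false y = refl
xor-cancelˡ true  y = not-involutive y

xor≡false⇒≡ : ∀ {x y} → x xor y ≡ false → x ≡ y
xor≡false⇒≡ {x} {y} e = trans (sym (xor-cancelʳ x y)) (cong (_xor y) e)

xor-lswap : ∀ x y z → x xor (y xor z) ≡ y xor (x xor z)
xor-lswap = solve-∀ BoolRing

zeros : ∀ {k} → Vec Bool k
zeros = replicate _ false

ones : ∀ {k} → Vec Bool k
ones = replicate _ true

parity : ∀ {k} → Vec Bool k → Bool
parity []       = false
parity (x ∷ xs) = x xor parity xs

parity-zeros : ∀ k → parity (zeros {k}) ≡ false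
parity-zeros zero    = refl
parity-zeros (suc k) = parity-zeros k

-- A chain of k automata carries a token (true) at each unstable position.
-- A token entering the chain is xor-ed onto its head; when the chain is
-- empty it passes straight through.
inject : ∀ {k} → Vec Bool k → Vec Bool k
inject []       = []
inject (x ∷ xs) = not x ∷ xs

injectOut : ∀ {k} → Vec Bool k → Bool
injectOut []      = true
injectOut (_ ∷ _) = false

-- Firing position j moves its token (if any) one step forward;
-- fireOut records whether it leaves the chain at the far end.
fire : ∀ {k} → Fin k → Vec Bool k → Vec Bool k
fire zero    (false ∷ xs) = false ∷ xs
fire zero    (true ∷ xs)  = false ∷ inject xs
fire (suc j) (x ∷ xs)     = x ∷ fire j xs

fireOut : ∀ {k} → Fin k → Vec Bool k → Bool
fireOut zero    (false ∷ xs) = false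
fireOut zero    (true ∷ xs)  = injectOut xs
fireOut (suc j) (x ∷ xs)     = fireOut j xs

inject-involutive : ∀ {k} (v : Vec Bool k) → inject (inject v) ≡ v
inject-involutive []      = refl
inject-involutive (x ∷ v) = cong (_∷ v) (not-involutive x)

inject-parity : ∀ {k} (xs : Vec Bool k) → injectOut xs xor parity (inject xs) ≡ not (parity xs)
inject-parity []           = refl
inject-parity (true ∷ xs)  = sym (not-involutive (parity xs))
inject-parity (false ∷ xs) = refl

fire-parity : ∀ {k} (j : Fin k) v → fireOut j v xor parity (fire j v) ≡ parity v
fire-parity zero    (false ∷ xs) = refl
fire-parity zero    (true ∷ xs)  = inject-parity xs
fire-parity (suc j) (x ∷ xs)     =
  trans (xor-lswap (fireOut j xs) x _) (cong (x xor_) (fire-parity j xs))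

-- The effect of a sequence of firings on a chain: the final contents and
-- the parity of the number of tokens that left it.
record Outcome (k : ℕ) : Set where
  constructor outcome
  field
    final : Vec Bool k
    out   : Bool
open Outcome

chainRun : ∀ {k} → List (Fin k) → Vec Bool k → Outcome k
chainRun []       v = outcome v false
chainRun (j ∷ js) v =
  outcome (final (chainRun js (fire j v))) (fireOut j v xor out (chainRun js (fire j v)))

chainRun-++ : ∀ {k} (xs ys : List (Fin k)) v →
  chainRun (xs ++ ys) v ≡
  outcome (final (chainRun ys (final (chainRun xs v))))
          (out (chainRun xs v) xor out (chainRun ys (final (chainRun xs v))))
chainRun-++ []       ys v = refl
chainRun-++ (x ∷ xs) ys v rewrite chainRun-++ xs ys (fire x v) =
  cong (outcome _) (sym (xor-assoc (fireOut x v) _ _))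

chainRun-tail : ∀ {k} (js : List (Fin k)) x v →
  chainRun (map suc js) (x ∷ v) ≡ outcome (x ∷ final (chainRun js v)) (out (chainRun js v))
chainRun-tail []       x v = refl
chainRun-tail (j ∷ js) x v rewrite chainRun-tail js x (fire j v) = refl

chainRun-parity : ∀ {k} (js : List (Fin k)) v →
  out (chainRun js v) xor parity (final (chainRun js v)) ≡ parity v
chainRun-parity []       v = refl
chainRun-parity (j ∷ js) v = begin
  (fireOut j v xor out r) xor parity (final r) ≡⟨ xor-assoc (fireOut j v) _ _ ⟩
  fireOut j v xor (out r xor parity (final r)) ≡⟨ cong (fireOut j v xor_) (chainRun-parity js (fire j v)) ⟩
  fireOut j v xor parity (fire j v)            ≡⟨ fire-parity j v ⟩
  parity v                                     ∎
  where
  open ≡-Reasoning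
  r = chainRun js (fire j v)

out-by-parity : ∀ {k} (js : List (Fin k)) v →
  out (chainRun js v) ≡ parity v xor parity (final (chainRun js v))
out-by-parity js v = begin
  out r                              ≡⟨ sym (xor-cancelʳ (out r) (parity (final r))) ⟩
  (out r xor parity (final r)) xor parity (final r) ≡⟨ cong (_xor parity (final r)) (chainRun-parity js v) ⟩
  parity v xor parity (final r)      ∎
  where
  open ≡-Reasoning
  r = chainRun js v

sweep : ∀ k → List (Fin k)
sweep zero    = []
sweep (suc k) = zero ∷ map suc (sweep k)

length-sweep : ∀ k → length (sweep k) ≡ k
length-sweep zero    = refl
length-sweep (suc k) = cong suc (trans (length-map suc (sweep k)) (length-sweep k))

sweep-empties : ∀ {k} (v : Vec Bool k) → chainRun (sweep k) v ≡ outcome zeros (parity v)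
sweep-empties []           = refl
sweep-empties (false ∷ xs) rewrite chainRun-tail (sweep _) false xs | sweep-empties xs = refl
sweep-empties (true ∷ xs)
  rewrite chainRun-tail (sweep _) false (inject xs) | sweep-empties (inject xs) =
  cong (outcome _) (inject-parity xs)

shift : ∀ k → List (Fin k)
shift zero    = []
shift (suc k) = map suc (shift k) ++ [ zero ]

length-shift : ∀ k → length (shift k) ≡ k
length-shift zero    = refl
length-shift (suc k) = begin
  length (map suc (shift k) ++ [ zero ]) ≡⟨ length-++ (map suc (shift k)) ⟩
  length (map suc (shift k)) + 1         ≡⟨ cong (_+ 1) (trans (length-map suc (shift k)) (length-shift k)) ⟩
  k + 1                                  ≡⟨ +-comm k 1 ⟩
  suc k                                  ∎
  where open ≡-Reasoning

shift-full : ∀ k → chainRun (shift (suc k)) ones ≡ outcome (false ∷ ones) true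
shift-full zero    = refl
shift-full (suc k)
  rewrite chainRun-++ (map suc (shift (suc k))) [ zero ] (ones {suc (suc k)})
        | chainRun-tail (shift (suc k)) true ones | shift-full k = refl

carve : ∀ {k} → Vec Bool k → List (Fin k)
carve []                = []
carve (true ∷ w)        = map suc (carve w)
carve (false ∷ [])      = [ zero ]
carve (false ∷ y ∷ w)   = map suc (carve (not y ∷ w)) ++ [ zero ]

length-carve : ∀ {k} (w : Vec Bool k) → length (carve w) ≤ k
length-carve []              = z≤n
length-carve (true ∷ w)      =
  subst (_≤ suc _) (sym (length-map suc (carve w))) (≤-trans (length-carve w) (n≤1+n _))
length-carve (false ∷ [])    = s≤s z≤n
length-carve (false ∷ y ∷ w) =
  subst (_≤ suc (suc _)) (sym (trans (length-++ (map suc (carve (not y ∷ w))))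
                               (trans (cong (_+ 1) (length-map suc (carve (not y ∷ w)))) (+-comm _ 1))))
        (s≤s (length-carve (not y ∷ w)))

carve-final : ∀ {k} (w : Vec Bool k) → final (chainRun (carve w) ones) ≡ w
carve-final []         = refl
carve-final (true ∷ w) rewrite chainRun-tail (carve w) true ones = cong (true ∷_) (carve-final w)
carve-final (false ∷ []) = refl
carve-final {suc (suc k)} (false ∷ y ∷ w) = begin
  final (chainRun (map suc c ++ [ zero ]) ones)
    ≡⟨ cong final (chainRun-++ (map suc c) [ zero ] ones) ⟩
  final (chainRun [ zero ] (final (chainRun (map suc c) (true ∷ ones))))
    ≡⟨ cong (λ r → final (chainRun [ zero ] (final r))) (chainRun-tail c true ones) ⟩
  final (chainRun [ zero ] (true ∷ final (chainRun c ones)))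
    ≡⟨ cong (λ u → final (chainRun [ zero ] (true ∷ u))) (carve-final (not y ∷ w)) ⟩
  false ∷ not (not y) ∷ w
    ≡⟨ cong (λ z → false ∷ z ∷ w) (not-involutive y) ⟩
  false ∷ y ∷ w ∎
  where
  open ≡-Reasoning
  c = carve (not y ∷ w)

allOnes : ∀ {k} → Vec Bool k → Bool
allOnes []       = true
allOnes (x ∷ xs) = x ∧ allOnes xs

allOnes-ones : ∀ {k} (v : Vec Bool k) → allOnes v ≡ true → v ≡ ones
allOnes-ones []           e = refl
allOnes-ones (true ∷ xs)  e = cong (true ∷_) (allOnes-ones xs e)

anyToken : ∀ {k} → Vec Bool k → Bool
anyToken []       = false
anyToken (x ∷ xs) = x ∨ anyToken xs

anyToken-zeros : ∀ {k} (v : Vec Bool k) → anyToken v ≡ false → v ≡ zeros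
anyToken-zeros []           e = refl
anyToken-zeros (false ∷ xs) e = cong (false ∷_) (anyToken-zeros xs e)

-- For a chain v that is not full, `charged v` puts an extra token on the
-- last empty position of v, and `emit v` pushes exactly that token out
-- through the full block behind it, restoring v.
charged : ∀ {k} → Vec Bool k → Vec Bool k
charged []       = []
charged (x ∷ xs) = if allOnes xs then true ∷ xs else x ∷ charged xs

emit : ∀ {k} → Vec Bool k → List (Fin k)
emit []           = []
emit {suc k} (x ∷ xs) = if allOnes xs then shift (suc k) else map suc (emit xs)

length-emit : ∀ {k} (v : Vec Bool k) → length (emit v) ≤ k
length-emit []           = z≤n
length-emit {suc k} (x ∷ xs) with allOnes xs
... | true  = ≤-reflexive (length-shift (suc k))
... | false = subst (_≤ suc k) (sym (length-map suc (emit xs))) (≤-trans (length-emit xs) (n≤1+n k))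

emit-charged : ∀ {k} (v : Vec Bool k) → allOnes v ≡ false → chainRun (emit v) (charged v) ≡ outcome v true
emit-charged {suc k} (x ∷ xs) notFull with allOnes xs in full
emit-charged {suc k} (false ∷ xs) notFull | true rewrite allOnes-ones xs full = shift-full k
emit-charged {suc k} (x ∷ xs)     notFull | false
  rewrite chainRun-tail (emit xs) x (charged xs) | emit-charged xs full = refl

expel : ∀ {k} → Vec Bool k → List (Fin k)
expel []             = []
expel {suc k} (x ∷ xs) = if anyToken xs then map suc (expel xs) else sweep (suc k)

length-expel : ∀ {k} (v : Vec Bool k) → length (expel v) ≤ k
length-expel []           = z≤n
length-expel {suc k} (x ∷ xs) with anyToken xs
... | true  = subst (_≤ suc k) (sym (length-map suc (expel xs))) (≤-trans (length-expel xs) (n≤1+n k))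
... | false = ≤-reflexive (length-sweep (suc k))

expel-out : ∀ {k} (v : Vec Bool k) → anyToken v ≡ true → out (chainRun (expel v) v) ≡ true
expel-out {suc k} (x ∷ xs) nonEmpty with anyToken xs in tokens
expel-out {suc k} (true ∷ xs) nonEmpty | false
  = trans (cong (λ u → out (chainRun (sweep (suc k)) (true ∷ u))) (anyToken-zeros xs tokens))
          (trans (cong out (sweep-empties (true ∷ zeros {k}))) (cong not (parity-zeros k)))
expel-out {suc k} (x ∷ xs)    nonEmpty | true
  rewrite chainRun-tail (expel xs) x xs = expel-out xs tokens

-- The token state of a ⊕-BADC with n₁ = suc a and n₂ = suc b: whether the
-- central automaton is unstable, and the two chains i¹₂…i¹_{n₁}, i²₂…i²_{n₂}.
record Tokens (a b : ℕ) : Set where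
  constructor tokens
  field
    hub    : Bool
    chain₁ : Vec Bool a
    chain₂ : Vec Bool b

tokens-≡ : ∀ {a b c c'} {L L' : Vec Bool a} {R R' : Vec Bool b} →
  c ≡ c' → L ≡ L' → R ≡ R' → tokens c L R ≡ tokens c' L' R'
tokens-≡ refl refl refl = refl

step : ∀ {a b} → Node a b → Tokens a b → Tokens a b
step center    (tokens false L R) = tokens false L R
step center    (tokens true L R)  = tokens (injectOut L xor injectOut R) (inject L) (inject R)
step (left j)  (tokens c L R)     = tokens (c xor fireOut j L) (fire j L) R
step (right j) (tokens c L R)     = tokens (c xor fireOut j R) L (fire j R)

steps : ∀ {a b} → List (Node a b) → Tokens a b → Tokens a b
steps []       s = s
steps (i ∷ is) s = steps is (step i s)

steps-++ : ∀ {a b} (xs ys : List (Node a b)) s → steps (xs ++ ys) s ≡ steps ys (steps xs s)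
steps-++ []       ys s = refl
steps-++ (x ∷ xs) ys s = steps-++ xs ys (step x s)

noTokens : ∀ {a b} → Tokens a b
noTokens = tokens false zeros zeros

hubOnly : ∀ {a b} → Tokens a b
hubOnly = tokens true zeros zeros

-- The parity of the number of tokens. It is invariant under every update
-- except that of an unstable central automaton, which flips it.
charge : ∀ {a b} → Tokens a b → Bool
charge (tokens c L R) = c xor (parity L xor parity R)

center-flips-charge : ∀ {a b} (L : Vec Bool a) (R : Vec Bool b) →
  charge (step center (tokens true L R)) ≡ not (charge (tokens true L R))
center-flips-charge L R = begin
  (injectOut L xor injectOut R) xor (parity (inject L) xor parity (inject R))
    ≡⟨ regroup (injectOut L) (injectOut R) (parity (inject L)) (parity (inject R)) ⟩
  (injectOut L xor parity (inject L)) xor (injectOut R xor parity (inject R))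
    ≡⟨ cong₂ _xor_ (inject-parity L) (inject-parity R) ⟩
  not (parity L) xor not (parity R)
    ≡⟨ xor-annihilates-not (parity L) (parity R) ⟩
  parity L xor parity R
    ≡⟨ sym (not-involutive _) ⟩
  not (true xor (parity L xor parity R)) ∎
  where
  open ≡-Reasoning
  regroup : ∀ p q r s → (p xor q) xor (r xor s) ≡ (p xor r) xor (q xor s)
  regroup = solve-∀ BoolRing

record Reach {a b} (m : ℕ) (s t : Tokens a b) : Set where
  constructor reach
  field
    schedule : List (Node a b)
    short    : length schedule ≤ m
    arrives  : steps schedule s ≡ t

infixr 5 _⨾_
_⨾_ : ∀ {a b m m'} {s t u : Tokens a b} → Reach m s t → Reach m' t u → Reach (m + m') s u
reach w₁ l₁ e₁ ⨾ reach w₂ l₂ e₂ =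
  reach (w₁ ++ w₂) (subst (_≤ _) (sym (length-++ w₁)) (+-mono-≤ l₁ l₂))
        (trans (steps-++ w₁ w₂ _) (trans (cong (steps w₂) e₁) e₂))

relax : ∀ {a b m m'} {s t : Tokens a b} → m ≤ m' → Reach m s t → Reach m' s t
relax le (reach w l e) = reach w (≤-trans l le) e

arriving : ∀ {a b m} {s t t' : Tokens a b} → t ≡ t' → Reach m s t → Reach m s t'
arriving refl r = r

single : ∀ {a b} (i : Node a b) s → Reach 1 s (step i s)
single i s = reach [ i ] ≤-refl refl

steps-left : ∀ {a b} (js : List (Fin a)) c L (R : Vec Bool b) →
  steps (map left js) (tokens c L R) ≡ tokens (c xor out (chainRun js L)) (final (chainRun js L)) R
steps-left []       c L R = cong (λ z → tokens z L R) (sym (xor-identityʳ c))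
steps-left (j ∷ js) c L R rewrite steps-left js (c xor fireOut j L) (fire j L) R =
  cong (λ z → tokens z _ R) (xor-assoc c (fireOut j L) _)

steps-right : ∀ {a b} (js : List (Fin b)) c (L : Vec Bool a) R →
  steps (map right js) (tokens c L R) ≡ tokens (c xor out (chainRun js R)) L (final (chainRun js R))
steps-right []       c L R = cong (λ z → tokens z L R) (sym (xor-identityʳ c))
steps-right (j ∷ js) c L R rewrite steps-right js (c xor fireOut j R) L (fire j R) =
  cong (λ z → tokens z L _) (xor-assoc c (fireOut j R) _)

runLeft : ∀ {a b} (js : List (Fin a)) c L (R : Vec Bool b) →
  Reach (length js) (tokens c L R) (tokens (c xor out (chainRun js L)) (final (chainRun js L)) R)
runLeft js c L R = reach (map left js) (≤-reflexive (length-map left js)) (steps-left js c L R)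

runRight : ∀ {a b} (js : List (Fin b)) c (L : Vec Bool a) R →
  Reach (length js) (tokens c L R) (tokens (c xor out (chainRun js R)) L (final (chainRun js R)))
runRight js c L R = reach (map right js) (≤-reflexive (length-map right js)) (steps-right js c L R)

runLeft-charge : ∀ {a b} (js : List (Fin a)) c L (R : Vec Bool b) →
  charge (tokens (c xor out (chainRun js L)) (final (chainRun js L)) R) ≡ charge (tokens c L R)
runLeft-charge js c L R = begin
  (c xor o) xor (parity F xor parity R) ≡⟨ regroup c o (parity F) (parity R) ⟩
  c xor ((o xor parity F) xor parity R) ≡⟨ cong (λ p → c xor (p xor parity R)) (chainRun-parity js L) ⟩
  c xor (parity L xor parity R)         ∎
  where
  open ≡-Reasoning
  o = out (chainRun js L)
  F = final (chainRun js L)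
  regroup : ∀ c o f r → (c xor o) xor (f xor r) ≡ c xor ((o xor f) xor r)
  regroup = solve-∀ BoolRing

runRight-charge : ∀ {a b} (js : List (Fin b)) c (L : Vec Bool a) R →
  charge (tokens (c xor out (chainRun js R)) L (final (chainRun js R))) ≡ charge (tokens c L R)
runRight-charge js c L R = begin
  (c xor o) xor (parity L xor parity F) ≡⟨ regroup c o (parity L) (parity F) ⟩
  c xor (parity L xor (o xor parity F)) ≡⟨ cong (λ p → c xor (parity L xor p)) (chainRun-parity js R) ⟩
  c xor (parity L xor parity R)         ∎
  where
  open ≡-Reasoning
  o = out (chainRun js R)
  F = final (chainRun js R)
  regroup : ∀ c o l f → (c xor o) xor (l xor f) ≡ c xor (l xor (o xor f))
  regroup = solve-∀ BoolRing

-- The token state that no update can produce from a different state: every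
-- chain automaton unstable, and the hub unstable exactly when both or none
-- of the cycles have length one.
blocked : ∀ a b → Tokens a b
blocked zero    zero    = tokens true [] []
blocked zero    (suc m) = tokens false [] ones
blocked (suc k) zero    = tokens false ones []
blocked (suc k) (suc m) = tokens true ones ones

-- No update produces the blocked state from a different state: a fired
-- position ends stable, and the hub update always changes the hub.
fire-clears : ∀ {k} (j : Fin k) v → lookup (fire j v) j ≡ false
fire-clears zero    (false ∷ xs) = refl
fire-clears zero    (true ∷ xs)  = refl
fire-clears (suc j) (x ∷ xs)     = fire-clears j xs

fire-stable : ∀ {k} (j : Fin k) v → lookup v j ≡ false → fire j v ≡ v × fireOut j v ≡ false
fire-stable zero    (false ∷ xs) _      = refl , refl
fire-stable (suc j) (x ∷ xs)     stable with fire-stable j xs stable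
... | same , quiet = cong (x ∷_) same , quiet

fire-into-full : ∀ {k} (j : Fin k) v → fire j v ≡ ones → fire j v ≡ v × fireOut j v ≡ false
fire-into-full j v full with lookup v j in vj
... | false = fire-stable j v vj
... | true  = ⊥-elim (true≢false (trans (sym (lookup-replicate j true))
                                        (trans (cong (λ u → lookup u j) (sym full)) (fire-clears j v))))
  where
  true≢false : true ≡ false → ⊥
  true≢false ()

into-full-left : ∀ {a b} j c (L : Vec Bool a) (R : Vec Bool b) t →
  Tokens.chain₁ t ≡ ones → step (left j) (tokens c L R) ≡ t → tokens c L R ≡ t
into-full-left j c L R t full e with fire-into-full j L (trans (cong Tokens.chain₁ e) full)
... | same , quiet =
  trans (cong₂ (λ o F → tokens o F R) (trans (sym (xor-identityʳ c)) (cong (c xor_) (sym quiet))) (sym same)) e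

into-full-right : ∀ {a b} j c (L : Vec Bool a) (R : Vec Bool b) t →
  Tokens.chain₂ t ≡ ones → step (right j) (tokens c L R) ≡ t → tokens c L R ≡ t
into-full-right j c L R t full e with fire-into-full j R (trans (cong Tokens.chain₂ e) full)
... | same , quiet =
  trans (cong₂ (λ o F → tokens o L F) (trans (sym (xor-identityʳ c)) (cong (c xor_) (sym quiet))) (sym same)) e

step-into-blocked : ∀ a b (i : Node a b) s → step i s ≡ blocked a b → s ≡ blocked a b
step-into-blocked a       b       center (tokens false L R) e = e
step-into-blocked zero    zero    center (tokens true [] [])           ()
step-into-blocked zero    (suc m) center (tokens true [] (y ∷ R))      ()
step-into-blocked (suc k) zero    center (tokens true (x ∷ L) [])      ()
step-into-blocked (suc k) (suc m) center (tokens true (x ∷ L) (y ∷ R)) ()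
step-into-blocked (suc k) zero    (left j)  (tokens c L R) e = into-full-left j c L R _ refl e
step-into-blocked (suc k) (suc m) (left j)  (tokens c L R) e = into-full-left j c L R _ refl e
step-into-blocked zero    (suc m) (right j) (tokens c L R) e = into-full-right j c L R _ refl e
step-into-blocked (suc k) (suc m) (right j) (tokens c L R) e = into-full-right j c L R _ refl e

sweepLeft : ∀ {a b} c (L : Vec Bool a) (R : Vec Bool b) →
  Reach a (tokens c L R) (tokens (c xor parity L) zeros R)
sweepLeft {a} c L R = relax (≤-reflexive (length-sweep a))
  (arriving (cong (λ r → tokens (c xor out r) (final r) R) (sweep-empties L)) (runLeft (sweep a) c L R))

sweepRight : ∀ {a b} c (L : Vec Bool a) (R : Vec Bool b) →
  Reach b (tokens c L R) (tokens (c xor parity R) L zeros)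
sweepRight {b = b} c L R = relax (≤-reflexive (length-sweep b))
  (arriving (cong (λ r → tokens (c xor out r) L (final r)) (sweep-empties R)) (runRight (sweep b) c L R))

-- Sweeping both chains sends every token to the hub, where tokens cancel in pairs.
sweepAll : ∀ {a b} (s : Tokens a b) → Reach (a + b) s (tokens (charge s) zeros zeros)
sweepAll (tokens c L R) =
  arriving (cong (λ z → tokens z zeros zeros) (xor-assoc c (parity L) (parity R)))
    (sweepLeft c L R ⨾ sweepRight (c xor parity L) zeros R)

collect : ∀ {a b} (s : Tokens a b) → charge s ≡ true → Reach (a + b) s hubOnly
collect s odd = arriving (cong (λ c → tokens c zeros zeros) odd) (sweepAll s)

-- With an even charge and a token on the hub, firing the hub first makes the charge odd.
collectVia : ∀ {a b} (L : Vec Bool a) (R : Vec Bool b) →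
  charge (tokens true L R) ≡ false → Reach (1 + (a + b)) (tokens true L R) hubOnly
collectVia L R even = single center _ ⨾ collect _ (trans (center-flips-charge L R) (cong not even))

gatherBound : ℕ → ℕ → ℕ
gatherBound a b = (a + b) + (1 + (a + b))

-- Phase 1: from any state with a token, a single token can be gathered on
-- the hub. With even charge and a stable hub, one token is first expelled
-- from a non-empty chain onto the hub.
gather : ∀ {a b} (s : Tokens a b) → s ≢ noTokens → Reach (gatherBound a b) s hubOnly
gather s _ with charge s in ch
... | true = relax (m≤m+n _ _) (collect s ch)
gather (tokens true L R) _ | false = relax (m≤n+m _ _) (collectVia L R ch)
gather {a} {b} (tokens false L R) nonEmpty | false with anyToken L in tL | anyToken R in tR
... | true | _ = relax (+-mono-≤ (m≤m+n a b) ≤-refl) (expelled ⨾ collectVia L' R even)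
  where
  L' = final (chainRun (expel L) L)
  expelled : Reach a (tokens false L R) (tokens true L' R)
  expelled = arriving (cong (λ o → tokens o L' R) (expel-out L tL))
                      (relax (length-expel L) (runLeft (expel L) false L R))
  even : charge (tokens true L' R) ≡ false
  even = trans (cong (λ o → charge (tokens o L' R)) (sym (expel-out L tL)))
               (trans (runLeft-charge (expel L) false L R) ch)
... | false | true = relax (+-mono-≤ (m≤n+m b a) ≤-refl) (expelled ⨾ collectVia L R' even)
  where
  R' = final (chainRun (expel R) R)
  expelled : Reach b (tokens false L R) (tokens true L R')
  expelled = arriving (cong (λ o → tokens o L R') (expel-out R tR))
                      (relax (length-expel R) (runRight (expel R) false L R))
  even : charge (tokens true L R') ≡ false
  even = trans (cong (λ o → charge (tokens o L R')) (sym (expel-out R tR)))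
               (trans (runRight-charge (expel R) false L R) ch)
... | false | false = ⊥-elim (nonEmpty (cong₂ (tokens false) (anyToken-zeros L tL) (anyToken-zeros R tR)))

-- A writer is a way of encoding k+1 bits as token states so that one fixed
-- schedule `toggle` flips the first bit and the update `move j` fires bit j
-- whenever no token leaves the encoded chain. Any bit vector can then be
-- written from all zeros, one bit at a time from the back.
record Writer (a b k : ℕ) : Set where
  field
    encode       : Vec Bool (suc k) → Tokens a b
    toggle       : List (Node a b)
    move         : Fin (suc k) → Node a b
    toggle-flips : ∀ x v → steps toggle (encode (x ∷ v)) ≡ encode (not x ∷ v)
    move-fires   : ∀ j v → fireOut j v ≡ false → step (move j) (encode v) ≡ encode (fire j v)
open Writer

-- Toggling the first bit and firing it toggles the second one.
tailWriter : ∀ {a b k} → Writer a b (suc k) → Writer a b k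
tailWriter W = record
  { encode       = λ v → encode W (false ∷ v)
  ; toggle       = toggle W ++ [ move W zero ]
  ; move         = λ j → move W (suc j)
  ; toggle-flips = λ x v → trans (steps-++ (toggle W) [ move W zero ] _)
      (trans (cong (step (move W zero)) (toggle-flips W false (x ∷ v)))
             (move-fires W zero (true ∷ x ∷ v) refl))
  ; move-fires   = λ j v → move-fires W (suc j) (false ∷ v)
  }

toggleIf : ∀ {a b} → Bool → List (Node a b) → List (Node a b)
toggleIf x l = if x then l else []

write : ∀ {a b} k → Writer a b k → Vec Bool (suc k) → List (Node a b)
write zero    W (x ∷ []) = toggleIf x (toggle W)
write (suc k) W (x ∷ v)  = write k (tailWriter W) v ++ toggleIf x (toggle W)

toggleIf-correct : ∀ {a b k} (W : Writer a b k) x v →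
  steps (toggleIf x (toggle W)) (encode W (false ∷ v)) ≡ encode W (x ∷ v)
toggleIf-correct W true  v = toggle-flips W false v
toggleIf-correct W false v = refl

write-correct : ∀ {a b} k (W : Writer a b k) v → steps (write k W v) (encode W zeros) ≡ encode W v
write-correct zero    W (x ∷ []) = toggleIf-correct W x []
write-correct (suc k) W (x ∷ v)  = begin
  steps (write k (tailWriter W) v ++ toggleIf x (toggle W)) (encode W zeros)
    ≡⟨ steps-++ (write k (tailWriter W) v) (toggleIf x (toggle W)) _ ⟩
  steps (toggleIf x (toggle W)) (steps (write k (tailWriter W) v) (encode (tailWriter W) zeros))
    ≡⟨ cong (steps (toggleIf x (toggle W))) (write-correct k (tailWriter W) v) ⟩
  steps (toggleIf x (toggle W)) (encode W (false ∷ v))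
    ≡⟨ toggleIf-correct W x v ⟩
  encode W (x ∷ v) ∎
  where open ≡-Reasoning

length-toggleIf : ∀ {a b} x (l : List (Node a b)) → length (toggleIf x l) ≤ length l
length-toggleIf true  l = ≤-refl
length-toggleIf false l = z≤n

-- Each of the k+1 bits costs at most one toggle schedule and k moves.
write-length : ∀ {a b} k (W : Writer a b k) v →
  length (write k W v) ≤ suc k * (length (toggle W) + k)
write-length zero W (x ∷ []) =
  ≤-trans (length-toggleIf x (toggle W)) (≤-reflexive (unit (length (toggle W))))
  where
  unit : ∀ t → t ≡ 1 * (t + 0)
  unit = ℕ.solve-∀
write-length (suc k) W (x ∷ v) = begin
  length (write k (tailWriter W) v ++ toggleIf x (toggle W))
    ≡⟨ length-++ (write k (tailWriter W) v) ⟩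
  length (write k (tailWriter W) v) + length (toggleIf x (toggle W))
    ≤⟨ +-mono-≤ (write-length k (tailWriter W) v) (length-toggleIf x (toggle W)) ⟩
  suc k * (length (toggle W ++ [ move W zero ]) + k) + t
    ≡⟨ cong (λ z → suc k * (z + k) + t) (length-++ (toggle W)) ⟩
  suc k * (t + 1 + k) + t
    ≤⟨ m≤m+n _ (suc k) ⟩
  suc k * (t + 1 + k) + t + suc k
    ≡⟨ arith k t ⟩
  suc (suc k) * (t + suc k) ∎
  where
  open ≤-Reasoning
  t = length (toggle W)
  arith : ∀ k t → suc k * (t + 1 + k) + t + suc k ≡ suc (suc k) * (t + suc k)
  arith = ℕ.solve-∀

writeReach : ∀ {a b k} (W : Writer a b k) v →
  Reach (suc k * (length (toggle W) + k)) (encode W zeros) (encode W v)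
writeReach {k = k} W v = reach (write k W v) (write-length k W v) (write-correct k W v)

-- Carving a full chain: the tokens that leave are determined by conservation.
carveLeft : ∀ {a b} c (L' : Vec Bool a) (R : Vec Bool b) →
  Reach a (tokens c ones R) (tokens (c xor (parity (ones {a}) xor parity L')) L' R)
carveLeft {a} c L' R = relax (length-carve L')
  (arriving (cong₂ (λ o F → tokens (c xor o) F R) leaving (carve-final L')) (runLeft (carve L') c ones R))
  where
  leaving : out (chainRun (carve L') ones) ≡ parity (ones {a}) xor parity L'
  leaving = trans (out-by-parity (carve L') ones) (cong (λ F → parity (ones {a}) xor parity F) (carve-final L'))

carveRight : ∀ {a b} c (L : Vec Bool a) (R' : Vec Bool b) →
  Reach b (tokens c L ones) (tokens (c xor (parity (ones {b}) xor parity R')) L R')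
carveRight {b = b} c L R' = relax (length-carve R')
  (arriving (cong₂ (λ o F → tokens (c xor o) L F) leaving (carve-final R')) (runRight (carve R') c L ones))
  where
  leaving : out (chainRun (carve R') ones) ≡ parity (ones {b}) xor parity R'
  leaving = trans (out-by-parity (carve R') ones) (cong (λ F → parity (ones {b}) xor parity F) (carve-final R'))

fromFull : ∀ {a b} c c' (L' : Vec Bool a) (R' : Vec Bool b) →
  charge (tokens c' L' R') ≡ charge (tokens {a} {b} c ones ones) →
  Reach (a + b) (tokens c ones ones) (tokens c' L' R')
fromFull {a} {b} c c' L' R' sameCharge =
  arriving (cong (λ z → tokens z L' R') hub) (carveLeft c L' ones ⨾ carveRight _ L' R')
  where
  open ≡-Reasoning
  p₁ = parity (ones {a})
  p₂ = parity (ones {b})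
  hub : (c xor (p₁ xor parity L')) xor (p₂ xor parity R') ≡ c'
  hub = begin
    (c xor (p₁ xor parity L')) xor (p₂ xor parity R')
      ≡⟨ regroup c p₁ p₂ (parity L') (parity R') ⟩
    (c xor (p₁ xor p₂)) xor (parity L' xor parity R')
      ≡⟨ cong (_xor (parity L' xor parity R')) (sym sameCharge) ⟩
    (c' xor (parity L' xor parity R')) xor (parity L' xor parity R')
      ≡⟨ xor-cancelʳ c' _ ⟩
    c' ∎
    where
    regroup : ∀ c p q l r → (c xor (p xor l)) xor (q xor r) ≡ (c xor (p xor q)) xor (l xor r)
    regroup = solve-∀ BoolRing

emitLeft : ∀ {a b} c (L' : Vec Bool a) (R : Vec Bool b) → allOnes L' ≡ false →
  Reach a (tokens c (charged L') R) (tokens (c xor true) L' R)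
emitLeft c L' R notFull = relax (length-emit L')
  (arriving (cong (λ r → tokens (c xor out r) (final r) R) (emit-charged L' notFull)) (runLeft (emit L') c (charged L') R))

emitRight : ∀ {a b} c (L : Vec Bool a) (R' : Vec Bool b) → allOnes R' ≡ false →
  Reach b (tokens c L (charged R')) (tokens (c xor true) L R')
emitRight c L R' notFull = relax (length-emit R')
  (arriving (cong (λ r → tokens (c xor out r) L (final r)) (emit-charged R' notFull)) (runRight (emit R') c L (charged R')))

-- Phase 2 when both cycles have length at least two (a = suc k, b = suc m).
-- The only state that cannot be reached is the one where every automaton
-- is unstable.
module TwoChains (k m : ℕ) where

  A B : ℕ
  A = suc k
  B = suc m

  full : Tokens A B
  full = tokens false ones ones

  -- Write chain 1 while the hub keeps its token: firing the hub toggles the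
  -- head of chain 1 and sends a token into chain 2, which is swept back.
  writer₁ : Writer A B k
  writer₁ = record
    { encode       = λ v → tokens true v zeros
    ; toggle       = center ∷ map right (sweep B)
    ; move         = left
    ; toggle-flips = λ x v → trans (steps-right (sweep B) false (not x ∷ v) (true ∷ zeros))
        (cong₂ (λ o R → tokens o (not x ∷ v) R)
               (trans (cong out (sweep-empties (true ∷ zeros {m}))) (cong not (parity-zeros m)))
               (cong final (sweep-empties (true ∷ zeros {m}))))
    ; move-fires   = λ j v noExit → cong (λ z → tokens (true xor z) (fire j v) zeros) noExit
    }

  -- Write chain 2 while chain 1 holds false ∷ ones: the token the hub sends
  -- into chain 1 is shifted through it back to the hub.
  writer₂ : Writer A B m
  writer₂ = record
    { encode       = λ w → tokens true (false ∷ ones) w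
    ; toggle       = center ∷ map left (shift A)
    ; move         = right
    ; toggle-flips = λ x w → trans (steps-left (shift A) false (true ∷ ones) (not x ∷ w))
        (cong (λ r → tokens (false xor out r) (final r) (not x ∷ w)) (shift-full k))
    ; move-fires   = λ j w noExit → cong (λ z → tokens (true xor z) (false ∷ ones) (fire j w)) noExit
    }

  fillBound : ℕ
  fillBound = A * (suc B + k) + (B * (suc A + m) + 1)

  fill : Reach fillBound hubOnly full
  fill = relax (≤-reflexive (cong (λ t → A * (t + k)) toggle₁)) (writeReach writer₁ (false ∷ ones))
       ⨾ relax (≤-reflexive (cong (λ t → B * (t + m)) toggle₂)) (writeReach writer₂ (false ∷ ones))
       ⨾ single center _
    where
    toggle₁ : length (toggle writer₁) ≡ suc B
    toggle₁ = cong suc (trans (length-map right (sweep B)) (length-sweep B))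
    toggle₂ : length (toggle writer₂) ≡ suc A
    toggle₂ = cong suc (trans (length-map left (shift A)) (length-shift A))

  -- Every state with a stable hub is reachable from `full`: directly by
  -- carving if the charges agree, otherwise by carving its predecessor
  -- under a hub update, which has the opposite charge.
  toStableHub : ∀ L' R' → Reach (A + B + 1) full (tokens false L' R')
  toStableHub L' R' with charge (tokens false L' R') ≟ charge full
  ... | yes same = relax (m≤m+n _ 1) (fromFull false false L' R' same)
  toStableHub (x ∷ L'') (y ∷ R'') | no differ =
    arriving (cong₂ (tokens false) (inject-involutive (x ∷ L'')) (inject-involutive (y ∷ R'')))
      (fromFull false true (inject (x ∷ L'')) (inject (y ∷ R'')) flipped ⨾ single center _)
    where
    L' = x ∷ L''
    R' = y ∷ R''
    flipped : charge (tokens true (inject L') (inject R')) ≡ charge full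
    flipped = begin
      not (parity (inject L') xor parity (inject R'))
        ≡⟨ cong not (cong₂ _xor_ (inject-parity L') (inject-parity R')) ⟩
      not (not (parity L') xor not (parity R'))
        ≡⟨ cong not (xor-annihilates-not (parity L') (parity R')) ⟩
      not (charge (tokens false L' R'))
        ≡⟨ sym (¬-not (differ ∘ sym)) ⟩
      charge full ∎
      where open ≡-Reasoning

  fromFullBound : ℕ
  fromFullBound = (A + B + 1) + (A + B)

  -- Every other state: a state with an unstable hub is reached by emitting
  -- a token from a chain that is not full.
  spreadFromFull : ∀ t → t ≢ blocked A B → Reach fromFullBound full t
  spreadFromFull (tokens false L' R') _ = relax (m≤m+n _ _) (toStableHub L' R')
  spreadFromFull (tokens true L' R') notBlocked with allOnes L' in fullL | allOnes R' in fullR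
  ... | false | _ = relax (+-monoʳ-≤ (A + B + 1) (m≤m+n A B)) (toStableHub (charged L') R' ⨾ emitLeft false L' R' fullL)
  ... | true | false = relax (+-monoʳ-≤ (A + B + 1) (m≤n+m B A)) (toStableHub L' (charged R') ⨾ emitRight false L' R' fullR)
  ... | true | true = ⊥-elim (notBlocked (cong₂ (tokens true) (allOnes-ones L' fullL) (allOnes-ones R' fullR)))

  spread : ∀ t → t ≢ blocked A B → Reach (fillBound + fromFullBound) hubOnly t
  spread t notBlocked = fill ⨾ spreadFromFull t notBlocked

-- Phase 2 when cycle 2 has length one (b = 0): the hub is its own
-- successor, so firing an unstable hub keeps it unstable and toggles the
-- head of chain 1. The unreachable state has every automaton unstable but
-- the hub.
module OneChain (k : ℕ) where

  A : ℕ
  A = suc k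

  writer : Writer A 0 k
  writer = record
    { encode       = λ v → tokens true v []
    ; toggle       = [ center ]
    ; move         = left
    ; toggle-flips = λ x v → refl
    ; move-fires   = λ j v noExit → cong (λ z → tokens (true xor z) (fire j v) []) noExit
    }

  spread : ∀ t → t ≢ blocked A 0 → Reach (A * (1 + k) + A) hubOnly t
  spread (tokens true L' []) _ = relax (m≤m+n _ _) (writeReach writer L')
  spread (tokens false L' []) notBlocked with allOnes L' in fullL
  ... | false = writeReach writer (charged L') ⨾ emitLeft true L' [] fullL
  ... | true  = ⊥-elim (notBlocked (cong (λ v → tokens false v []) (allOnes-ones L' fullL)))

swapNode : ∀ {a b} → Node a b → Node b a
swapNode center    = center
swapNode (left j)  = right j
swapNode (right j) = left j

swapTokens : ∀ {a b} → Tokens a b → Tokens b a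
swapTokens (tokens c L R) = tokens c R L

step-swap : ∀ {a b} (i : Node a b) s → step (swapNode i) (swapTokens s) ≡ swapTokens (step i s)
step-swap center    (tokens false L R) = refl
step-swap center    (tokens true L R)  =
  cong (λ c → tokens c (inject R) (inject L)) (xor-comm (injectOut R) (injectOut L))
step-swap (left j)  (tokens c L R)     = refl
step-swap (right j) (tokens c L R)     = refl

steps-swap : ∀ {a b} (ws : List (Node a b)) s → steps (map swapNode ws) (swapTokens s) ≡ swapTokens (steps ws s)
steps-swap []       s = refl
steps-swap (i ∷ ws) s rewrite step-swap i s = steps-swap ws (step i s)

reach-swap : ∀ {a b m} {s t : Tokens a b} → Reach m s t → Reach m (swapTokens s) (swapTokens t)
reach-swap (reach w l e) =
  reach (map swapNode w) (subst (_≤ _) (sym (length-map swapNode w)) l) (trans (steps-swap w _) (cong swapTokens e))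

order : ℕ → ℕ → ℕ
order a b = a + b + 1

≤-square : ∀ {x} n → x ≤ n → x ≤ n * n
≤-square zero    le = le
≤-square (suc n) le = ≤-trans le (m≤m*n (suc n) (suc n))

five-squares : ∀ q → q + (q + q) + (q + q) ≡ 5 * q
five-squares = ℕ.solve-∀

bound-two : ∀ k m → TwoChains.fillBound k m + TwoChains.fromFullBound k m ≤ 5 * (order (suc k) (suc m) * order (suc k) (suc m))
bound-two k m = begin
  A * (suc B + k) + (B * (suc A + m) + 1) + ((A + B + 1) + (A + B))
    ≤⟨ +-mono-≤ (+-mono-≤ (*-mono-≤ A≤n (≤-trans (≤-reflexive gap₁) AB≤n))
                          (+-mono-≤ (*-mono-≤ B≤n (≤-trans (≤-reflexive gap₂) AB≤n)) (≤-square n (m≤n+m 1 (A + B)))))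
                (+-mono-≤ (≤-square n ≤-refl) (≤-square n AB≤n)) ⟩
  n * n + (n * n + n * n) + (n * n + n * n)
    ≡⟨ five-squares (n * n) ⟩
  5 * (n * n) ∎
  where
  open ≤-Reasoning
  A = suc k
  B = suc m
  n = A + B + 1
  AB≤n : A + B ≤ n
  AB≤n = m≤m+n (A + B) 1
  A≤n : A ≤ n
  A≤n = ≤-trans (m≤m+n A B) AB≤n
  B≤n : B ≤ n
  B≤n = ≤-trans (m≤n+m B A) AB≤n
  gap₁ : suc B + k ≡ A + B
  gap₁ = cong suc (+-comm B k)
  gap₂ : suc A + m ≡ A + B
  gap₂ = sym (+-suc A m)

bound-one : ∀ k n → suc k ≤ n → suc k * (1 + k) + suc k ≤ 5 * (n * n)
bound-one k n A≤n = begin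
  suc k * suc k + suc k     ≤⟨ +-mono-≤ (*-mono-≤ A≤n A≤n) (≤-square n A≤n) ⟩
  n * n + n * n             ≤⟨ m≤m+n _ (3 * (n * n)) ⟩
  n * n + n * n + 3 * (n * n) ≡⟨ two+three (n * n) ⟩
  5 * (n * n)               ∎
  where
  open ≤-Reasoning
  two+three : ∀ q → q + q + 3 * q ≡ 5 * q
  two+three = ℕ.solve-∀

bound-gather : ∀ a b → gatherBound a b ≤ 2 * (order a b * order a b)
bound-gather a b = begin
  (a + b) + (1 + (a + b)) ≤⟨ +-mono-≤ (≤-square n (m≤m+n (a + b) 1)) (≤-square n (≤-reflexive (+-comm 1 (a + b)))) ⟩
  n * n + n * n           ≡⟨ cong (n * n +_) (sym (+-identityʳ (n * n))) ⟩
  2 * (n * n)             ∎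
  where
  open ≤-Reasoning
  n = order a b

spread : ∀ a b (t : Tokens a b) → t ≢ blocked a b → Reach (5 * (order a b * order a b)) hubOnly t
spread zero zero (tokens false [] []) _ = relax (s≤s z≤n) (single center hubOnly)
spread zero zero (tokens true [] []) notBlocked = ⊥-elim (notBlocked refl)
spread (suc k) zero t notBlocked =
  relax (bound-one k _ (≤-trans (m≤m+n (suc k) 0) (m≤m+n _ 1))) (OneChain.spread k t notBlocked)
spread zero (suc m) (tokens c L R) notBlocked =
  relax (bound-one m _ (m≤m+n (suc m) 1))
        (reach-swap (OneChain.spread m (tokens c R L) (notBlocked ∘ cong swapTokens)))
spread (suc k) (suc m) t notBlocked = relax (bound-two k m) (TwoChains.spread k m t notBlocked)

tokenReach : ∀ a b (s t : Tokens a b) → s ≢ noTokens → t ≢ blocked a b →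
  Reach (7 * (order a b * order a b)) s t
tokenReach a b s t nonEmpty notBlocked =
  relax (≤-reflexive (seven (order a b * order a b)))
        (relax (bound-gather a b) (gather s nonEmpty) ⨾ spread a b t notBlocked)
  where
  seven : ∀ q → 2 * q + 5 * q ≡ 7 * q
  seven = ℕ.solve-∀

_≐_ : ∀ {n} → Fin n → Fin n → Bool
j ≐ k = toℕ j ≡ᵇ toℕ k

_↦_ : ∀ {n} → Fin n → Fin n → Bool
j ↦ k = suc (toℕ j) ≡ᵇ toℕ k

lookup-inject : ∀ {n} (v : Vec Bool n) k → lookup (inject v) k ≡ lookup v k xor (0 ≡ᵇ toℕ k)
lookup-inject (true ∷ xs)  zero    = refl
lookup-inject (false ∷ xs) zero    = refl
lookup-inject (x ∷ xs)     (suc k) = sym (xor-identityʳ _)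

injectOut-empty : ∀ {n} (v : Vec Bool n) → injectOut v ≡ (0 ≡ᵇ n)
injectOut-empty []      = refl
injectOut-empty (x ∷ v) = refl

lookup-fire : ∀ {n} (j k : Fin n) v →
  lookup (fire j v) k ≡ lookup v k xor ((lookup v j ∧ (j ≐ k)) xor (lookup v j ∧ (j ↦ k)))
lookup-fire zero    k       (false ∷ xs) = sym (xor-identityʳ _)
lookup-fire zero    zero    (true ∷ xs)  = refl
lookup-fire zero    (suc k) (true ∷ xs)  = lookup-inject xs k
lookup-fire (suc j) zero    (x ∷ xs)     = sym (trans (cong (λ d → x xor (d xor d)) (∧-zeroʳ (lookup xs j))) (xor-identityʳ x))
lookup-fire (suc j) (suc k) (x ∷ xs)     = lookup-fire j k xs

fireOut-end : ∀ {n} (j : Fin n) v → fireOut j v ≡ lookup v j ∧ (suc (toℕ j) ≡ᵇ n)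
fireOut-end zero    (false ∷ xs) = refl
fireOut-end zero    (true ∷ xs)  = injectOut-empty xs
fireOut-end (suc j) (x ∷ xs)     = fireOut-end j xs

tabulate-≡ : ∀ {n} {g : Fin n → Bool} {v : Vec Bool n} → (∀ k → g k ≡ lookup v k) → tabulate g ≡ v
tabulate-≡ {v = v} pointwise = trans (tabulate-cong pointwise) (tabulate∘lookup v)

sameNode-sound : ∀ {a b} (i j : Node a b) → sameNode i j ≡ true → i ≡ j
sameNode-sound center    center    _ = refl
sameNode-sound (left i)  (left j)  e = cong left (toℕ-injective (≡ᵇ⇒≡ _ _ (subst T (sym e) _)))
sameNode-sound (right i) (right j) e = cong right (toℕ-injective (≡ᵇ⇒≡ _ _ (subst T (sym e) _)))

left-predL : ∀ {a b} (j k : Fin a) → sameNode {a} {b} (left j) (predL k) ≡ j ↦ k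
left-predL j zero    = refl
left-predL j (suc k) = cong (toℕ j ≡ᵇ_) (toℕ-inject₁ k)

right-predR : ∀ {a b} (j k : Fin b) → sameNode {a} {b} (right j) (predR k) ≡ j ↦ k
right-predR j zero    = refl
right-predR j (suc k) = cong (toℕ j ≡ᵇ_) (toℕ-inject₁ k)

left-predR : ∀ {a b} (j : Fin a) (k : Fin b) → sameNode {a} {b} (left j) (predR k) ≡ false
left-predR j zero    = refl
left-predR j (suc k) = refl

right-predL : ∀ {a b} (j : Fin b) (k : Fin a) → sameNode {a} {b} (right j) (predL k) ≡ false
right-predL j zero    = refl
right-predL j (suc k) = refl

center-predL : ∀ {a b} (k : Fin a) → sameNode {a} {b} center (predL k) ≡ (0 ≡ᵇ toℕ k)
center-predL zero    = refl
center-predL (suc k) = refl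

center-predR : ∀ {a b} (k : Fin b) → sameNode {a} {b} center (predR k) ≡ (0 ≡ᵇ toℕ k)
center-predR zero    = refl
center-predR (suc k) = refl

left-last1 : ∀ {a b} (j : Fin a) → sameNode (left j) (last1 {a} {b}) ≡ (suc (toℕ j) ≡ᵇ a)
left-last1 {suc a} j = cong (toℕ j ≡ᵇ_) (toℕ-fromℕ a)

right-last2 : ∀ {a b} (j : Fin b) → sameNode (right j) (last2 {a} {b}) ≡ (suc (toℕ j) ≡ᵇ b)
right-last2 {b = suc b} j = cong (toℕ j ≡ᵇ_) (toℕ-fromℕ b)

left-last2 : ∀ {a b} (j : Fin a) → sameNode (left j) (last2 {a} {b}) ≡ false
left-last2 {b = zero}  j = refl
left-last2 {b = suc b} j = refl

right-last1 : ∀ {a b} (j : Fin b) → sameNode (right j) (last1 {a} {b}) ≡ false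
right-last1 {zero}  j = refl
right-last1 {suc a} j = refl

center-last1 : ∀ {a b} → sameNode center (last1 {a} {b}) ≡ (0 ≡ᵇ a)
center-last1 {zero}  = refl
center-last1 {suc a} = refl

center-last2 : ∀ {a b} → sameNode center (last2 {a} {b}) ≡ (0 ≡ᵇ b)
center-last2 {b = zero}  = refl
center-last2 {b = suc b} = refl

-- The local function of a copying automaton is affine with the same constant
-- for every configuration, so differences of configurations cancel it.
copy-difference : ∀ x s y x' y' → (x xor (s xor y)) xor (x' xor (s xor y')) ≡ (x xor x') xor (y xor y')
copy-difference x s y x' y' = begin
  (x xor (s xor y)) xor (x' xor (s xor y'))  ≡⟨ regroup x s y x' y' ⟩
  ((x xor x') xor (y xor y')) xor (s xor s)  ≡⟨ cong (((x xor x') xor (y xor y')) xor_) (xor-same s) ⟩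
  ((x xor x') xor (y xor y')) xor false      ≡⟨ xor-identityʳ _ ⟩
  (x xor x') xor (y xor y')                  ∎
  where
  open ≡-Reasoning
  regroup : ∀ x s y x' y' → (x xor (s xor y)) xor (x' xor (s xor y')) ≡ ((x xor x') xor (y xor y')) xor (s xor s)
  regroup = solve-∀ BoolRing

center-difference : ∀ x t₁ y₁ t₂ y₂ x' y₁' y₂' →
  (x xor ((t₁ xor y₁) xor (t₂ xor y₂))) xor (x' xor ((t₁ xor y₁') xor (t₂ xor y₂'))) ≡
  (x xor x') xor ((y₁ xor y₁') xor (y₂ xor y₂'))
center-difference x t₁ y₁ t₂ y₂ x' y₁' y₂' = begin
  (x xor ((t₁ xor y₁) xor (t₂ xor y₂))) xor (x' xor ((t₁ xor y₁') xor (t₂ xor y₂')))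
    ≡⟨ regroup x t₁ y₁ t₂ y₂ x' y₁' y₂' ⟩
  D xor ((t₁ xor t₁) xor (t₂ xor t₂))
    ≡⟨ cong₂ (λ p q → D xor (p xor q)) (xor-same t₁) (xor-same t₂) ⟩
  D xor false
    ≡⟨ xor-identityʳ D ⟩
  D ∎
  where
  open ≡-Reasoning
  D = (x xor x') xor ((y₁ xor y₁') xor (y₂ xor y₂'))
  regroup : ∀ x t₁ y₁ t₂ y₂ x' y₁' y₂' →
    (x xor ((t₁ xor y₁) xor (t₂ xor y₂))) xor (x' xor ((t₁ xor y₁') xor (t₂ xor y₂'))) ≡
    ((x xor x') xor ((y₁ xor y₁') xor (y₂ xor y₂'))) xor ((t₁ xor t₁) xor (t₂ xor t₂))
  regroup = solve-∀ BoolRing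

chain₁-constant : ∀ {a b} (δ : Node a b → Bool) → (∀ k → δ (left k) ≡ δ (predL k)) → ∀ k → δ (left k) ≡ δ center
chain₁-constant {suc a} δ arc = <-weakInduction (λ k → δ (left k) ≡ δ center) (arc zero) (λ j ih → trans (arc (suc j)) ih)

chain₂-constant : ∀ {a b} (δ : Node a b → Bool) → (∀ k → δ (right k) ≡ δ (predR k)) → ∀ k → δ (right k) ≡ δ center
chain₂-constant {b = suc b} δ arc = <-weakInduction (λ k → δ (right k) ≡ δ center) (arc zero) (λ j ih → trans (arc (suc j)) ih)

last₁-constant : ∀ {a b} (δ : Node a b → Bool) → (∀ k → δ (left k) ≡ δ center) → δ (last1 {a} {b}) ≡ δ center
last₁-constant {zero}  δ constant = refl
last₁-constant {suc a} δ constant = constant (fromℕ a)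

last₂-constant : ∀ {a b} (δ : Node a b → Bool) → (∀ k → δ (right k) ≡ δ center) → δ (last2 {a} {b}) ≡ δ center
last₂-constant {b = zero}  δ constant = refl
last₂-constant {b = suc b} δ constant = constant (fromℕ b)

-- Updates of a BADC, seen through its unstable automata, are token moves.
module Instability (B : BADC) where

  unstable : Config B → Automaton B → Bool
  unstable z i = z i xor f B i z

  chain₁Of : Config B → Vec Bool (a B)
  chain₁Of z = tabulate (unstable z ∘ left)

  chain₂Of : Config B → Vec Bool (b B)
  chain₂Of z = tabulate (unstable z ∘ right)

  tokensOf : Config B → Tokens (a B) (b B)
  tokensOf z = tokens (unstable z center) (chain₁Of z) (chain₂Of z)

  last₁ last₂ : Automaton B
  last₁ = last1
  last₂ = last2

  update-flips : ∀ i z j → update B i z j ≡ z j xor (unstable z i ∧ sameNode i j)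
  update-flips i z j with sameNode i j in same
  ... | false = sym (trans (cong (z j xor_) (∧-zeroʳ _)) (xor-identityʳ _))
  ... | true with sameNode-sound i j same
  ...   | refl = sym (trans (cong (z i xor_) (∧-identityʳ _)) (xor-cancelˡ (z i) (f B i z)))

  unstable-copy : ∀ i z n p σ → (∀ w → f B n w ≡ σ xor w p) →
    unstable (update B i z) n ≡
    unstable z n xor ((unstable z i ∧ sameNode i n) xor (unstable z i ∧ sameNode i p))
  unstable-copy i z n p σ local = begin
    update B i z n xor f B n (update B i z)
      ≡⟨ cong (update B i z n xor_) (local (update B i z)) ⟩
    update B i z n xor (σ xor update B i z p)
      ≡⟨ cong₂ (λ x y → x xor (σ xor y)) (update-flips i z n) (update-flips i z p) ⟩
    (z n xor (d ∧ sameNode i n)) xor (σ xor (z p xor (d ∧ sameNode i p)))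
      ≡⟨ regroup (z n) (d ∧ sameNode i n) σ (z p) (d ∧ sameNode i p) ⟩
    (z n xor (σ xor z p)) xor ((d ∧ sameNode i n) xor (d ∧ sameNode i p))
      ≡⟨ cong (λ y → (z n xor y) xor ((d ∧ sameNode i n) xor (d ∧ sameNode i p))) (sym (local z)) ⟩
    unstable z n xor ((d ∧ sameNode i n) xor (d ∧ sameNode i p)) ∎
    where
    open ≡-Reasoning
    d = unstable z i
    regroup : ∀ x u s y v → (x xor u) xor (s xor (y xor v)) ≡ (x xor (s xor y)) xor (u xor v)
    regroup = solve-∀ BoolRing

  unstable-center : ∀ i z →
    unstable (update B i z) center ≡
    unstable z center xor ((unstable z i ∧ sameNode i center) xor
                           ((unstable z i ∧ sameNode i last1) xor (unstable z i ∧ sameNode i last2)))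
  unstable-center i z = begin
    update B i z center xor ((tau1 B xor update B i z last1) xor (tau2 B xor update B i z last2))
      ≡⟨ cong₂ _xor_ (update-flips i z center)
                     (cong₂ (λ x y → (tau1 B xor x) xor (tau2 B xor y)) (update-flips i z last1) (update-flips i z last2)) ⟩
    (z center xor u) xor ((tau1 B xor (z last1 xor v₁)) xor (tau2 B xor (z last2 xor v₂)))
      ≡⟨ regroup (z center) u (tau1 B) (z last1) v₁ (tau2 B) (z last2) v₂ ⟩
    unstable z center xor (u xor (v₁ xor v₂)) ∎
    where
    open ≡-Reasoning
    u  = unstable z i ∧ sameNode i center
    v₁ = unstable z i ∧ sameNode i last1
    v₂ = unstable z i ∧ sameNode i last2
    regroup : ∀ x u t₁ y₁ v₁ t₂ y₂ v₂ →
      (x xor u) xor ((t₁ xor (y₁ xor v₁)) xor (t₂ xor (y₂ xor v₂))) ≡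
      (x xor ((t₁ xor y₁) xor (t₂ xor y₂))) xor (u xor (v₁ xor v₂))
    regroup = solve-∀ BoolRing

  chain₁-after : ∀ i z k → unstable (update B i z) (left k) ≡
    unstable z (left k) xor ((unstable z i ∧ sameNode i (left k)) xor (unstable z i ∧ sameNode i (predL k)))
  chain₁-after i z k = unstable-copy i z (left k) (predL k) (sig1 B k) (λ _ → refl)

  chain₂-after : ∀ i z k → unstable (update B i z) (right k) ≡
    unstable z (right k) xor ((unstable z i ∧ sameNode i (right k)) xor (unstable z i ∧ sameNode i (predR k)))
  chain₂-after i z k = unstable-copy i z (right k) (predR k) (sig2 B k) (λ _ → refl)

  quiet : ∀ x d → x xor ((d ∧ false) xor (d ∧ false)) ≡ x
  quiet = solve-∀ BoolRing

  quiet₁ : ∀ x d e → x xor ((d ∧ false) xor ((d ∧ e) xor (d ∧ false))) ≡ x xor (d ∧ e)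
  quiet₁ = solve-∀ BoolRing

  quiet₂ : ∀ x d e → x xor ((d ∧ false) xor ((d ∧ false) xor (d ∧ e))) ≡ x xor (d ∧ e)
  quiet₂ = solve-∀ BoolRing

  update-left : ∀ j z → tokensOf (update B (left j) z) ≡ step (left j) (tokensOf z)
  update-left j z = tokens-≡ hub chain₁ chain₂
    where
    open ≡-Reasoning
    u = unstable z
    d = u (left j)
    L = chain₁Of z
    hub : unstable (update B (left j) z) center ≡ u center xor fireOut j L
    hub = begin
      unstable (update B (left j) z) center
        ≡⟨ unstable-center (left j) z ⟩
      u center xor ((d ∧ false) xor ((d ∧ sameNode (left j) last₁) xor (d ∧ sameNode (left j) last₂)))
        ≡⟨ cong₂ (λ s₁ s₂ → u center xor ((d ∧ false) xor ((d ∧ s₁) xor (d ∧ s₂)))) (left-last1 {b = b B} j) (left-last2 {b = b B} j) ⟩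
      u center xor ((d ∧ false) xor ((d ∧ (suc (toℕ j) ≡ᵇ a B)) xor (d ∧ false)))
        ≡⟨ quiet₁ (u center) d _ ⟩
      u center xor (d ∧ (suc (toℕ j) ≡ᵇ a B))
        ≡⟨ cong (u center xor_) (sym (trans (fireOut-end j L) (cong (_∧ _) (lookup∘tabulate _ j)))) ⟩
      u center xor fireOut j L ∎
    chain₁ : chain₁Of (update B (left j) z) ≡ fire j L
    chain₁ = tabulate-≡ λ k → begin
      unstable (update B (left j) z) (left k)
        ≡⟨ chain₁-after (left j) z k ⟩
      u (left k) xor ((d ∧ (j ≐ k)) xor (d ∧ sameNode (left j) (predL k)))
        ≡⟨ cong (λ s → u (left k) xor ((d ∧ (j ≐ k)) xor (d ∧ s))) (left-predL j k) ⟩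
      u (left k) xor ((d ∧ (j ≐ k)) xor (d ∧ (j ↦ k)))
        ≡⟨ sym (trans (lookup-fire j k L) (cong₂ (λ x y → x xor ((y ∧ (j ≐ k)) xor (y ∧ (j ↦ k))))
                                                (lookup∘tabulate _ k) (lookup∘tabulate _ j))) ⟩
      lookup (fire j L) k ∎
    chain₂ : chain₂Of (update B (left j) z) ≡ chain₂Of z
    chain₂ = tabulate-cong λ k → begin
      unstable (update B (left j) z) (right k)
        ≡⟨ chain₂-after (left j) z k ⟩
      u (right k) xor ((d ∧ false) xor (d ∧ sameNode (left j) (predR k)))
        ≡⟨ cong (λ s → u (right k) xor ((d ∧ false) xor (d ∧ s))) (left-predR j k) ⟩
      u (right k) xor ((d ∧ false) xor (d ∧ false))
        ≡⟨ quiet (u (right k)) d ⟩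
      u (right k) ∎

  update-right : ∀ j z → tokensOf (update B (right j) z) ≡ step (right j) (tokensOf z)
  update-right j z = tokens-≡ hub chain₁ chain₂
    where
    open ≡-Reasoning
    u = unstable z
    d = u (right j)
    R = chain₂Of z
    hub : unstable (update B (right j) z) center ≡ u center xor fireOut j R
    hub = begin
      unstable (update B (right j) z) center
        ≡⟨ unstable-center (right j) z ⟩
      u center xor ((d ∧ false) xor ((d ∧ sameNode (right j) last₁) xor (d ∧ sameNode (right j) last₂)))
        ≡⟨ cong₂ (λ s₁ s₂ → u center xor ((d ∧ false) xor ((d ∧ s₁) xor (d ∧ s₂)))) (right-last1 {a B} j) (right-last2 {a B} j) ⟩
      u center xor ((d ∧ false) xor ((d ∧ false) xor (d ∧ (suc (toℕ j) ≡ᵇ b B))))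
        ≡⟨ quiet₂ (u center) d _ ⟩
      u center xor (d ∧ (suc (toℕ j) ≡ᵇ b B))
        ≡⟨ cong (u center xor_) (sym (trans (fireOut-end j R) (cong (_∧ _) (lookup∘tabulate _ j)))) ⟩
      u center xor fireOut j R ∎
    chain₁ : chain₁Of (update B (right j) z) ≡ chain₁Of z
    chain₁ = tabulate-cong λ k → begin
      unstable (update B (right j) z) (left k)
        ≡⟨ chain₁-after (right j) z k ⟩
      u (left k) xor ((d ∧ false) xor (d ∧ sameNode (right j) (predL k)))
        ≡⟨ cong (λ s → u (left k) xor ((d ∧ false) xor (d ∧ s))) (right-predL j k) ⟩
      u (left k) xor ((d ∧ false) xor (d ∧ false))
        ≡⟨ quiet (u (left k)) d ⟩
      u (left k) ∎
    chain₂ : chain₂Of (update B (right j) z) ≡ fire j R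
    chain₂ = tabulate-≡ λ k → begin
      unstable (update B (right j) z) (right k)
        ≡⟨ chain₂-after (right j) z k ⟩
      u (right k) xor ((d ∧ (j ≐ k)) xor (d ∧ sameNode (right j) (predR k)))
        ≡⟨ cong (λ s → u (right k) xor ((d ∧ (j ≐ k)) xor (d ∧ s))) (right-predR j k) ⟩
      u (right k) xor ((d ∧ (j ≐ k)) xor (d ∧ (j ↦ k)))
        ≡⟨ sym (trans (lookup-fire j k R) (cong₂ (λ x y → x xor ((y ∧ (j ≐ k)) xor (y ∧ (j ↦ k))))
                                                (lookup∘tabulate _ k) (lookup∘tabulate _ j))) ⟩
      lookup (fire j R) k ∎

  update-stable-center : ∀ z → unstable z center ≡ false →
    tokensOf (update B center z) ≡ tokens false (chain₁Of z) (chain₂Of z)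
  update-stable-center z hubState = tokens-≡ hub (tabulate-cong chain₁) (tabulate-cong chain₂)
    where
    u = unstable z
    hub : unstable (update B center z) center ≡ false
    hub = trans (unstable-center center z)
                (cong (λ d → d xor ((d ∧ true) xor ((d ∧ sameNode center last₁) xor (d ∧ sameNode center last₂)))) hubState)
    chain₁ : ∀ k → unstable (update B center z) (left k) ≡ u (left k)
    chain₁ k = trans (chain₁-after center z k)
      (trans (cong (λ d → u (left k) xor ((d ∧ false) xor (d ∧ sameNode center (predL k)))) hubState) (xor-identityʳ _))
    chain₂ : ∀ k → unstable (update B center z) (right k) ≡ u (right k)
    chain₂ k = trans (chain₂-after center z k)
      (trans (cong (λ d → u (right k) xor ((d ∧ false) xor (d ∧ sameNode center (predR k)))) hubState) (xor-identityʳ _))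

  update-unstable-center : ∀ z → unstable z center ≡ true →
    tokensOf (update B center z) ≡
    tokens (injectOut (chain₁Of z) xor injectOut (chain₂Of z)) (inject (chain₁Of z)) (inject (chain₂Of z))
  update-unstable-center z hubState = tokens-≡ hub (tabulate-≡ chain₁) (tabulate-≡ chain₂)
    where
    open ≡-Reasoning
    u = unstable z
    L = chain₁Of z
    R = chain₂Of z
    hub : unstable (update B center z) center ≡ injectOut L xor injectOut R
    hub = begin
      unstable (update B center z) center
        ≡⟨ unstable-center center z ⟩
      u center xor ((u center ∧ true) xor ((u center ∧ sameNode center last₁) xor (u center ∧ sameNode center last₂)))
        ≡⟨ cong (λ d → d xor ((d ∧ true) xor ((d ∧ sameNode center last₁) xor (d ∧ sameNode center last₂)))) hubState ⟩
      true xor (true xor (sameNode center last₁ xor sameNode center last₂))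
        ≡⟨ xor-cancelˡ true _ ⟩
      sameNode center last₁ xor sameNode center last₂
        ≡⟨ cong₂ _xor_ (trans (center-last1 {a B} {b B}) (sym (injectOut-empty L)))
                       (trans (center-last2 {a B} {b B}) (sym (injectOut-empty R))) ⟩
      injectOut L xor injectOut R ∎
    chain₁ : ∀ k → unstable (update B center z) (left k) ≡ lookup (inject L) k
    chain₁ k = begin
      unstable (update B center z) (left k)
        ≡⟨ chain₁-after center z k ⟩
      u (left k) xor ((u center ∧ false) xor (u center ∧ sameNode center (predL k)))
        ≡⟨ cong (λ d → u (left k) xor ((d ∧ false) xor (d ∧ sameNode center (predL k)))) hubState ⟩
      u (left k) xor sameNode center (predL k)
        ≡⟨ cong₂ _xor_ (sym (lookup∘tabulate _ k)) (center-predL k) ⟩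
      lookup L k xor (0 ≡ᵇ toℕ k)
        ≡⟨ sym (lookup-inject L k) ⟩
      lookup (inject L) k ∎
    chain₂ : ∀ k → unstable (update B center z) (right k) ≡ lookup (inject R) k
    chain₂ k = begin
      unstable (update B center z) (right k)
        ≡⟨ chain₂-after center z k ⟩
      u (right k) xor ((u center ∧ false) xor (u center ∧ sameNode center (predR k)))
        ≡⟨ cong (λ d → u (right k) xor ((d ∧ false) xor (d ∧ sameNode center (predR k)))) hubState ⟩
      u (right k) xor sameNode center (predR k)
        ≡⟨ cong₂ _xor_ (sym (lookup∘tabulate _ k)) (center-predR k) ⟩
      lookup R k xor (0 ≡ᵇ toℕ k)
        ≡⟨ sym (lookup-inject R k) ⟩
      lookup (inject R) k ∎

  update-center : ∀ z → tokensOf (update B center z) ≡ step center (tokensOf z)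
  update-center z with unstable z center in hubState
  ... | false = update-stable-center z hubState
  ... | true  = update-unstable-center z hubState

  tokensOf-update : ∀ i z → tokensOf (update B i z) ≡ step i (tokensOf z)
  tokensOf-update center    z = update-center z
  tokensOf-update (left j)  z = update-left j z
  tokensOf-update (right j) z = update-right j z

  tokensOf-run : ∀ ws z → tokensOf (run B ws z) ≡ steps ws (tokensOf z)
  tokensOf-run []       z = refl
  tokensOf-run (i ∷ ws) z = trans (tokensOf-run ws (update B i z)) (cong (steps ws) (tokensOf-update i z))

  tokenAt : Tokens (a B) (b B) → Automaton B → Bool
  tokenAt t center    = Tokens.hub t
  tokenAt t (left k)  = lookup (Tokens.chain₁ t) k
  tokenAt t (right k) = lookup (Tokens.chain₂ t) k

  tokenAt-tokensOf : ∀ z i → tokenAt (tokensOf z) i ≡ unstable z i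
  tokenAt-tokensOf z center    = refl
  tokenAt-tokensOf z (left k)  = lookup∘tabulate _ k
  tokenAt-tokensOf z (right k) = lookup∘tabulate _ k

  unstable-of : ∀ z t → tokensOf z ≡ t → ∀ i → unstable z i ≡ tokenAt t i
  unstable-of z t e i = trans (sym (tokenAt-tokensOf z i)) (cong (λ s → tokenAt s i) e)

  -- A configuration is determined by its unstable automata: the difference
  -- δ of two configurations with the same tokens is constant along each
  -- cycle, and at the central automaton δ = δ xor δ xor δ = 0.
  tokensOf-injective : ∀ z w → tokensOf z ≡ tokensOf w → _≈_ {B} z w
  tokensOf-injective z w e i = xor≡false⇒≡ (vanishes i)
    where
    open ≡-Reasoning
    δ : Automaton B → Bool
    δ i = z i xor w i
    same : ∀ i → unstable z i ≡ unstable w i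
    same i = trans (unstable-of z _ e i) (tokenAt-tokensOf w i)
    along : ∀ n p σ → (∀ v → f B n v ≡ σ xor v p) → δ n ≡ δ p
    along n p σ local = xor≡false⇒≡ (begin
      δ n xor δ p                                ≡⟨ sym (copy-difference (z n) σ (z p) (w n) (w p)) ⟩
      (z n xor (σ xor z p)) xor (w n xor (σ xor w p)) ≡⟨ cong₂ (λ x y → (z n xor x) xor (w n xor y)) (sym (local z)) (sym (local w)) ⟩
      unstable z n xor unstable w n              ≡⟨ cong (_xor unstable w n) (same n) ⟩
      unstable w n xor unstable w n              ≡⟨ xor-same (unstable w n) ⟩
      false                                      ∎)
    alongL : ∀ k → δ (left k) ≡ δ center
    alongL = chain₁-constant δ λ k → along (left k) (predL k) (sig1 B k) (λ _ → refl)
    alongR : ∀ k → δ (right k) ≡ δ center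
    alongR = chain₂-constant δ λ k → along (right k) (predR k) (sig2 B k) (λ _ → refl)
    hubDifference : δ center xor (δ last₁ xor δ last₂) ≡ false
    hubDifference = begin
      δ center xor (δ last₁ xor δ last₂)
        ≡⟨ sym (center-difference (z center) (tau1 B) (z last₁) (tau2 B) (z last₂) (w center) (w last₁) (w last₂)) ⟩
      unstable z center xor unstable w center ≡⟨ cong (_xor unstable w center) (same center) ⟩
      unstable w center xor unstable w center ≡⟨ xor-same (unstable w center) ⟩
      false ∎
    vanishes : ∀ i → δ i ≡ false
    vanishes center = begin
      δ center                               ≡⟨ sym (xor-cancelˡ (δ center) (δ center)) ⟩
      δ center xor (δ center xor δ center)   ≡⟨ cong₂ (λ p q → δ center xor (p xor q)) (sym (last₁-constant δ alongL)) (sym (last₂-constant δ alongR)) ⟩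
      δ center xor (δ last₁ xor δ last₂)     ≡⟨ hubDifference ⟩
      false                                  ∎
    vanishes (left k)  = trans (alongL k) (vanishes center)
    vanishes (right k) = trans (alongR k) (vanishes center)

  f-cong : ∀ z w → _≈_ {B} z w → ∀ i → f B i z ≡ f B i w
  f-cong z w z≈w center    = cong₂ (λ p q → (tau1 B xor p) xor (tau2 B xor q)) (z≈w last₁) (z≈w last₂)
  f-cong z w z≈w (left j)  = cong (sig1 B j xor_) (z≈w (predL j))
  f-cong z w z≈w (right j) = cong (sig2 B j xor_) (z≈w (predR j))

  tokensOf-cong : ∀ z w → _≈_ {B} z w → tokensOf z ≡ tokensOf w
  tokensOf-cong z w z≈w = tokens-≡ (same center) (tabulate-cong (same ∘ left)) (tabulate-cong (same ∘ right))
    where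
    same : ∀ i → unstable z i ≡ unstable w i
    same i = cong₂ _xor_ (z≈w i) (f-cong z w z≈w i)

  fixed-of-noTokens : ∀ x → tokensOf x ≡ noTokens → FixedPoint B x
  fixed-of-noTokens x e i = sym (xor≡false⇒≡ (trans (unstable-of x _ e i) (noToken i)))
    where
    noToken : ∀ i → tokenAt noTokens i ≡ false
    noToken center    = refl
    noToken (left k)  = lookup-replicate k false
    noToken (right k) = lookup-replicate k false

  unreachable-of-blocked : ∀ y → tokensOf y ≡ blocked (a B) (b B) → Unreachable B y
  unreachable-of-blocked y e z i updated = tokensOf-injective z y (begin
    tokensOf z                  ≡⟨ step-into-blocked (a B) (b B) i (tokensOf z) (begin
      step i (tokensOf z)         ≡⟨ sym (tokensOf-update i z) ⟩
      tokensOf (update B i z)     ≡⟨ tokensOf-cong _ y updated ⟩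
      tokensOf y                  ≡⟨ e ⟩
      blocked (a B) (b B)         ∎) ⟩
    blocked (a B) (b B)         ≡⟨ sym e ⟩
    tokensOf y                  ∎)
    where open ≡-Reasoning

open Reach

upper-bound : ∀ B (x y : Config B) → ¬ FixedPoint B x → ¬ Unreachable B y →
  ReachableWithin B (7 * (size B * size B)) x y
upper-bound B x y moving reachable =
  schedule r , short r , tokensOf-injective (run B (schedule r) x) y (trans (tokensOf-run (schedule r) x) (arrives r))
  where
  open Instability B
  r = tokenReach (a B) (b B) (tokensOf x) (tokensOf y) (moving ∘ fixed-of-noTokens x) (reachable ∘ unreachable-of-blocked y)

bit : Bool → ℕ
bit true  = 1
bit false = 0

count : ∀ {k} → Vec Bool k → ℕ
count []       = 0
count (x ∷ xs) = bit x + count xs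

-- The weight of a chain is the sum of the positions (counted from 1) of its
-- tokens; an update moves a token by one position only.
weight : ∀ {k} → Vec Bool k → ℕ
weight []       = 0
weight (x ∷ xs) = count (x ∷ xs) + weight xs

count-inject : ∀ {k} (v : Vec Bool k) → count (inject v) ≤ suc (count v)
count-inject []           = z≤n
count-inject (true ∷ xs)  = ≤-trans (n≤1+n _) (n≤1+n _)
count-inject (false ∷ xs) = ≤-refl

weight-inject : ∀ {k} (v : Vec Bool k) → weight (inject v) ≤ suc (weight v)
weight-inject []           = z≤n
weight-inject (true ∷ xs)  = ≤-trans (n≤1+n _) (n≤1+n _)
weight-inject (false ∷ xs) = ≤-refl

count-fire : ∀ {k} (j : Fin k) v → count (fire j v) ≤ count v
count-fire zero    (false ∷ xs) = ≤-refl
count-fire zero    (true ∷ xs)  = count-inject xs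
count-fire (suc j) (x ∷ xs)     = +-monoʳ-≤ (bit x) (count-fire j xs)

weight-fire : ∀ {k} (j : Fin k) v → weight (fire j v) ≤ suc (weight v)
weight-fire zero    (false ∷ xs) = n≤1+n _
weight-fire zero    (true ∷ xs)  = begin
  count (inject xs) + weight (inject xs) ≤⟨ +-mono-≤ (count-inject xs) (weight-inject xs) ⟩
  suc (count xs) + suc (weight xs)       ≡⟨ cong suc (+-suc (count xs) (weight xs)) ⟩
  suc (suc (count xs + weight xs))       ∎
  where open ≤-Reasoning
weight-fire (suc j) (x ∷ xs)     = begin
  (bit x + count (fire j xs)) + weight (fire j xs) ≤⟨ +-mono-≤ (+-monoʳ-≤ (bit x) (count-fire j xs)) (weight-fire j xs) ⟩
  (bit x + count xs) + suc (weight xs)             ≡⟨ +-suc (bit x + count xs) (weight xs) ⟩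
  suc ((bit x + count xs) + weight xs)             ∎
  where open ≤-Reasoning

weight-step : ∀ {a b} (i : Node a b) s → weight (Tokens.chain₁ (step i s)) ≤ suc (weight (Tokens.chain₁ s))
weight-step center    (tokens false L R) = n≤1+n _
weight-step center    (tokens true L R)  = weight-inject L
weight-step (left j)  (tokens c L R)     = weight-fire j L
weight-step (right j) (tokens c L R)     = n≤1+n _

weight-steps : ∀ {a b} (ws : List (Node a b)) s →
  weight (Tokens.chain₁ (steps ws s)) ≤ length ws + weight (Tokens.chain₁ s)
weight-steps []       s = ≤-refl
weight-steps (i ∷ ws) s = ≤-trans (weight-steps ws (step i s))
  (≤-trans (+-monoʳ-≤ (length ws) (weight-step i s)) (≤-reflexive (+-suc (length ws) _)))

count-ones : ∀ m → count (ones {m}) ≡ m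
count-ones zero    = refl
count-ones (suc m) = cong suc (count-ones m)

weight-zeros : ∀ m → weight (zeros {m}) ≡ 0
weight-zeros zero    = refl
weight-zeros (suc m) = cong₂ _+_ (count-zeros m) (weight-zeros m)
  where
  count-zeros : ∀ m → count (zeros {m}) ≡ 0
  count-zeros zero    = refl
  count-zeros (suc m) = count-zeros m

weight-ones : ∀ m → weight (ones {m}) + weight (ones {m}) ≡ m * suc m
weight-ones zero    = refl
weight-ones (suc m) = begin
  (suc (count (ones {m})) + w) + (suc (count (ones {m})) + w)
    ≡⟨ cong (λ c → (suc c + w) + (suc c + w)) (count-ones m) ⟩
  (suc m + w) + (suc m + w)       ≡⟨ regroup m w ⟩
  2 * suc m + (w + w)             ≡⟨ cong (2 * suc m +_) (weight-ones m) ⟩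
  2 * suc m + m * suc m           ≡⟨ grow m ⟩
  suc m * suc (suc m) ∎
  where
  open ≡-Reasoning
  w = weight (ones {m})
  regroup : ∀ m w → (suc m + w) + (suc m + w) ≡ 2 * suc m + (w + w)
  regroup = ℕ.solve-∀
  grow : ∀ m → 2 * suc m + m * suc m ≡ suc m * suc (suc m)
  grow = ℕ.solve-∀

-- The family attaining the lower bound: cycle 1 of length N+4 with identity
-- arcs, and cycle 2 of length one, a loop on the central automaton.
loopedCycle : ℕ → BADC
loopedCycle N = record { a = 3 + N ; b = 0 ; sig1 = λ _ → false ; sig2 = λ () ; tau1 = false ; tau2 = false }

odd : ℕ → Bool
odd zero    = false
odd (suc n) = not (odd n)

-- From all automata true (only the hub is unstable) …
allOn : ∀ N → Config (loopedCycle N)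
allOn N _ = true

-- … to the alternating configuration, where all of cycle 1 but its first
-- automaton is unstable.
alternating : ∀ N → Config (loopedCycle N)
alternating N center   = false
alternating N (left j) = odd (toℕ j)

allOn-moving : ∀ N → ¬ FixedPoint (loopedCycle N) (allOn N)
allOn-moving N fixed with fixed center
... | ()

-- The alternating configuration is obtained by updating i¹₂ in another one.
alternating-reachable : ∀ N → ¬ Unreachable (loopedCycle N) (alternating N)
alternating-reachable N unreachable with unreachable before (left zero) updated (left zero)
  where
  before : Config (loopedCycle N)
  before center          = false
  before (left zero)     = true
  before (left (suc j))  = odd (suc (toℕ j))
  updated : _≈_ {loopedCycle N} (update (loopedCycle N) (left zero) before) (alternating N)
  updated center         = refl
  updated (left zero)    = refl
  updated (left (suc j)) = refl
... | ()

quadratic : ∀ N t → t + t ≡ (2 + N) * (3 + N) → (3 + N + 0 + 1) * (3 + N + 0 + 1) ≤ 4 * ((2 + N) + t)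
quadratic N t half = begin
  n * n                                 ≤⟨ m≤m+n (n * n) (N * N + 6 * N + 4) ⟩
  n * n + (N * N + 6 * N + 4)           ≡⟨ expand N ⟩
  4 * (2 + N) + 2 * ((2 + N) * (3 + N)) ≡⟨ cong (λ s → 4 * (2 + N) + 2 * s) (sym half) ⟩
  4 * (2 + N) + 2 * (t + t)             ≡⟨ sym (distribute N t) ⟩
  4 * ((2 + N) + t)                     ∎
  where
  open ≤-Reasoning
  n = 3 + N + 0 + 1
  expand : ∀ N → (3 + N + 0 + 1) * (3 + N + 0 + 1) + (N * N + 6 * N + 4) ≡ 4 * (2 + N) + 2 * ((2 + N) * (3 + N))
  expand = ℕ.solve-∀
  distribute : ∀ N t → 4 * ((2 + N) + t) ≡ 4 * (2 + N) + 2 * (t + t)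
  distribute = ℕ.solve-∀

-- Every schedule from allOn to alternating raises the weight of chain 1
-- from 0 to (N+2) + (N+2)(N+3)/2, one unit per update at most.
alternating-slow : ∀ N (ws : List (Automaton (loopedCycle N))) →
  _≈_ {loopedCycle N} (run (loopedCycle N) ws (allOn N)) (alternating N) →
  size (loopedCycle N) * size (loopedCycle N) ≤ 4 * length ws
alternating-slow N ws arrived = begin
  size B * size B
    ≤⟨ quadratic N (weight (ones {2 + N})) (weight-ones (2 + N)) ⟩
  4 * ((2 + N) + weight (ones {2 + N}))
    ≡⟨ cong (λ c → 4 * (c + weight (ones {2 + N}))) (sym (count-ones (2 + N))) ⟩
  4 * weight (false ∷ ones {2 + N})
    ≡⟨ cong (λ v → 4 * weight v) (sym targetChain) ⟩
  4 * weight (chain₁Of (alternating N))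
    ≡⟨ cong (λ t → 4 * weight (Tokens.chain₁ t)) (trans (sym (tokensOf-cong _ _ arrived)) (tokensOf-run ws (allOn N))) ⟩
  4 * weight (Tokens.chain₁ (steps ws (tokensOf (allOn N))))
    ≤⟨ *-monoʳ-≤ 4 (weight-steps ws (tokensOf (allOn N))) ⟩
  4 * (length ws + weight (chain₁Of (allOn N)))
    ≡⟨ cong (λ v → 4 * (length ws + weight v)) startChain ⟩
  4 * (length ws + weight (zeros {3 + N}))
    ≡⟨ cong (λ w → 4 * (length ws + w)) (weight-zeros (3 + N)) ⟩
  4 * (length ws + 0)
    ≡⟨ cong (4 *_) (+-identityʳ (length ws)) ⟩
  4 * length ws ∎
  where
  open ≤-Reasoning
  B = loopedCycle N
  open Instability B
  startChain : chain₁Of (allOn N) ≡ zeros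
  startChain = tabulate-≡ λ k → sym (lookup-replicate k false)
  targetChain : chain₁Of (alternating N) ≡ false ∷ ones
  targetChain = tabulate-≡ alternates
    where
    -- consecutive automata of cycle 1 differ, except i¹₂ and the hub
    alternates : ∀ k → unstable (alternating N) (left k) ≡ lookup (false ∷ ones {2 + N}) k
    alternates zero    = refl
    alternates (suc k) = trans (cong (λ p → not (odd (toℕ k)) xor odd p) (toℕ-inject₁ k))
                               (trans (xor-inverseˡ (odd (toℕ k))) (sym (lookup-replicate k true)))

lower-bound : ∀ N → Σ BADC λ B → (N ≤ size B) ×
  (Σ (Config B) λ x → Σ (Config B) λ y → ¬ FixedPoint B x × ¬ Unreachable B y ×
    (∀ (ws : List (Automaton B)) → _≈_ {B} (run B ws x) y → size B * size B ≤ 4 * length ws))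
lower-bound N = loopedCycle N , large , allOn N , alternating N ,
                allOn-moving N , alternating-reachable N , alternating-slow N
  where
  large : N ≤ size (loopedCycle N)
  large = ≤-trans (m≤n+m N 3) (≤-trans (m≤m+n (3 + N) 0) (m≤m+n (3 + N + 0) 1))

lemma2 : (Σ ℕ λ C → ∀ (B : BADC) (x y : Config B) → ¬ FixedPoint B x → ¬ Unreachable B y →
            ReachableWithin B (C * (size B * size B)) x y)
         × (Σ ℕ λ d → (0 < d) × (∀ (N : ℕ) → Σ BADC λ B → (N ≤ size B) ×
            (Σ (Config B) λ x → Σ (Config B) λ y → ¬ FixedPoint B x × ¬ Unreachable B y ×
              (∀ (ws : List (Automaton B)) → _≈_ {B} (run B ws x) y → size B * size B ≤ d * length ws))))
lemma2 = (7 , upper-bound) , (4 , s≤s z≤n , lower-bound)
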